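{- In any HST on $n$ leaves there exists a subset of the leaves of size at least $\sqrt{n}$ on which the induced HST is a binary/balanced HST.
   Context: A $1$-HST (HST) is a metric space on the leaves of a rooted tree $T$ with vertex labels $\Delta(u)\ge0$, $\Delta(u)=0$ iff $u$ is a leaf, $\Delta(u)\le\Delta(v)$ whenever $u$ is a child of $v$, and distance between leaves $x,y$ equal to $\Delta(\mathrm{lca}(x,y))$. The HST induced on a subset $S$ of leaves is represented by the subtree of $T$ formed by the union of root-to-leaf paths to leaves of $S$, with the same labels. A vertex is balanced if the numbers of leaves in any two subtrees rooted at its children differ by at most one. A binary/balanced HST is one in which every internal vertex of the underlying tree is either balanced or has at most two children.
   Formalization: The vertex labels Δ(u) of the HST are taken to be rational numbers. -}

module Defs where

open import Data.Nat using (ℕ; zero; suc; _+_; _*_; _≤_)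
open import Data.Bool using (Bool; true; false)
open import Data.Maybe using (Maybe; just; nothing)
open import Data.List using (List; []; _∷_; length; lookup)
open import Data.List.Relation.Unary.Any using (Any; here; there)
open import Data.List.Relation.Unary.All using (All)
open import Data.Fin using (Fin)
open import Data.Product using (_×_)
open import Data.Sum using (_⊎_)
open import Data.Rational using (ℚ; 0ℚ) renaming (_≤_ to _≤ℚ_)
open import Relation.Binary.PropositionalEquality using (_≡_)
open import Function.Bundles using (_⇔_)

data Tree : Set where
  node : ℚ → List Tree → Tree

label : Tree → ℚ
label (node q _) = q

data IsHST : Tree → Set where
  hst : ∀ {q ts} →
        0ℚ ≤ℚ q →
        (q ≡ 0ℚ ⇔ ts ≡ []) →
        All (λ c → label c ≤ℚ q) ts →
        All IsHST ts →
        IsHST (node q ts)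

-- Leaves of a tree, as root-to-leaf paths (identifying each leaf).
data Leaf : Tree → Set where
  leafHere : ∀ {q} → Leaf (node q [])
  leafIn   : ∀ {q ts} → Any Leaf ts → Leaf (node q ts)

mutual
  numLeaves : Tree → ℕ
  numLeaves (node q []) = 1
  numLeaves (node q (t ∷ ts)) = numLeavesL (t ∷ ts)

  numLeavesL : List Tree → ℕ
  numLeavesL [] = 0
  numLeavesL (t ∷ ts) = numLeaves t + numLeavesL ts

mutual
  card : (t : Tree) → (Leaf t → Bool) → ℕ
  card (node q []) S with S leafHere
  ... | true = 1
  ... | false = 0
  card (node q (t ∷ ts)) S = cardL (t ∷ ts) (λ p → S (leafIn p))

  cardL : (ts : List Tree) → (Any Leaf ts → Bool) → ℕ
  cardL [] S = 0
  cardL (t ∷ ts) S = card t (λ p → S (here p)) + cardL ts (λ p → S (there p))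

consMaybe : Maybe Tree → List Tree → List Tree
consMaybe nothing ts = ts
consMaybe (just t) ts = t ∷ ts

-- Induced HST on S: union of root-to-leaf paths to leaves of S, same labels.
-- 'nothing' when S is empty (the induced subtree is empty).
mutual
  induced : (t : Tree) → (Leaf t → Bool) → Maybe Tree
  induced (node q []) S with S leafHere
  ... | true = just (node q [])
  ... | false = nothing
  induced (node q (t ∷ ts)) S with inducedL (t ∷ ts) (λ p → S (leafIn p))
  ... | [] = nothing
  ... | c ∷ cs = just (node q (c ∷ cs))

  inducedL : (ts : List Tree) → (Any Leaf ts → Bool) → List Tree
  inducedL [] S = []
  inducedL (t ∷ ts) S =
    consMaybe (induced t (λ p → S (here p))) (inducedL ts (λ p → S (there p)))

Balanced : List Tree → Set
Balanced ts = (i j : Fin (length ts)) →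
  numLeaves (lookup ts i) ≤ numLeaves (lookup ts j) + 1

data BinBal : Tree → Set where
  binbal : ∀ {q ts} → (length ts ≤ 2 ⊎ Balanced ts) → All BinBal ts →
           BinBal (node q ts)

-- Every tree t admits a bound m ≥ 1 with numLeaves t ≤ m² such that, for each 1 ≤ s ≤ m,
-- some s leaves of t induce a binary/balanced tree with exactly s leaves. At a vertex whose
-- children have bounds m₁, …, m_k, with largest M and second largest g, one can take
-- F = max(M + g, max_{1≤t≤g} t·#{i : mᵢ ≥ t}): a size up to M + g is split between the two
-- largest children, and a size up to t·c is spread as evenly as possible over the c children
-- with mᵢ ≥ t, which makes the vertex balanced. Writing Σ mᵢ² as the layer cake
-- Σ_t (2t − 1)·#{i : mᵢ ≥ t} shows Σ mᵢ² ≤ F².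
module Submission where

open import Defs
open import Data.Nat
open import Data.Nat.Properties
open import Data.Nat.DivMod using (m≡m%n+[m/n]*n; m%n<n; m/n*n≤m)
open import Data.Nat.ListAction using (sum)
open import Data.Nat.Tactic.RingSolver using (solve-∀)
open import Algebra.Properties.CommutativeSemigroup +-commutativeSemigroup using (x∙yz≈y∙xz)
open import Data.Bool using (Bool; true; false)
open import Data.Maybe using (just; nothing)
open import Data.List using (List; []; _∷_; map; length; lookup)
open import Data.List.Properties using (map-id-local; length-map)
open import Data.List.Relation.Unary.All as All using (All; []; _∷_)
open import Data.List.Relation.Unary.All.Properties using (map⁻)
open import Data.List.Relation.Unary.Any using (Any; here; there)
open import Data.List.Relation.Binary.Pointwise using (Pointwise; []; _∷_)
open import Data.List.Membership.Propositional.Properties using (∈-lookup)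
open import Data.Product using (Σ; ∃-syntax; _×_; _,_; proj₁; proj₂)
open import Data.Sum using (_⊎_; inj₁; inj₂)
open import Data.Empty using (⊥-elim)
open import Function using (_∘_)
open import Relation.Nullary using (yes; no)
open import Relation.Binary.PropositionalEquality

sumSq : List ℕ → ℕ
sumSq [] = 0
sumSq (x ∷ xs) = x * x + sumSq xs

count≥ : ℕ → List ℕ → ℕ
count≥ t [] = 0
count≥ t (x ∷ xs) with t ≤? x
... | yes _ = suc (count≥ t xs)
... | no  _ = count≥ t xs

-- Layer cake: min(x, k)² = Σ_{t=1}^{k} (2t − 1)·[t ≤ x].
sumSq-⊓-suc : ∀ k xs →
  sumSq (map (suc k ⊓_) xs) ≡ sumSq (map (k ⊓_) xs) + (1 + 2 * k) * count≥ (suc k) xs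
sumSq-⊓-suc k [] = sym (*-zeroʳ (1 + 2 * k))
sumSq-⊓-suc k (x ∷ xs) with suc k ≤? x
... | yes k<x
  rewrite m≤n⇒m⊓n≡m k<x | m≤n⇒m⊓n≡m (<⇒≤ k<x) | sumSq-⊓-suc k xs =
  expand k (sumSq (map (k ⊓_) xs)) (count≥ (suc k) xs)
  where
  expand : ∀ k S c → suc k * suc k + (S + (1 + 2 * k) * c) ≡ k * k + S + (1 + 2 * k) * suc c
  expand = solve-∀
... | no k≮x
  rewrite m≥n⇒m⊓n≡n (≰⇒≥ k≮x) | m≥n⇒m⊓n≡n (≤-pred (≰⇒> k≮x)) | sumSq-⊓-suc k xs =
  sym (+-assoc (x * x) _ _)

sumSq-0⊓ : ∀ xs → sumSq (map (0 ⊓_) xs) ≡ 0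
sumSq-0⊓ [] = refl
sumSq-0⊓ (x ∷ xs) = sumSq-0⊓ xs

-- Since (2t − 1)·c ≤ 2t·(c + 1) − (2t − 1) and t·(c + 1) ≤ F, each layer contributes at
-- most 2F − (2t − 1); summing over t ≤ k gives 2Fk − k².
sumSq-⊓-bound : ∀ F k xs → (∀ t → 1 ≤ t → t ≤ k → t * suc (count≥ t xs) ≤ F) →
                sumSq (map (k ⊓_) xs) + k * k ≤ 2 * F * k
sumSq-⊓-bound F zero xs _ = ≤-reflexive (begin
  sumSq (map (0 ⊓_) xs) + 0 ≡⟨ cong (_+ 0) (sumSq-0⊓ xs) ⟩
  0                         ≡⟨ *-zeroʳ (2 * F) ⟨
  2 * F * 0                 ∎)
  where open ≡-Reasoning
sumSq-⊓-bound F (suc k) xs layer≤F = begin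
  sumSq (map (suc k ⊓_) xs) + suc k * suc k
    ≡⟨ cong (_+ suc k * suc k) (sumSq-⊓-suc k xs) ⟩
  S + (1 + 2 * k) * c + suc k * suc k
    ≡⟨ regroup S k c ⟩
  (S + k * k) + (1 + 2 * k) * suc c
    ≤⟨ +-mono-≤ (sumSq-⊓-bound F k xs (λ t 1≤t t≤k → layer≤F t 1≤t (m≤n⇒m≤1+n t≤k)))
                (*-monoˡ-≤ (suc c) (≤-trans (n≤1+n (1 + 2 * k)) (≤-reflexive (sym (*-suc 2 k))))) ⟩
  2 * F * k + 2 * suc k * suc c
    ≤⟨ +-monoʳ-≤ (2 * F * k) (≤-reflexive (*-assoc 2 (suc k) (suc c))) ⟩
  2 * F * k + 2 * (suc k * suc c)
    ≤⟨ +-monoʳ-≤ (2 * F * k) (*-monoʳ-≤ 2 (layer≤F (suc k) (s≤s z≤n) ≤-refl)) ⟩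
  2 * F * k + 2 * F
    ≡⟨ trans (*-suc (2 * F) k) (+-comm (2 * F) (2 * F * k)) ⟨
  2 * F * suc k ∎
  where
  open ≤-Reasoning
  S = sumSq (map (k ⊓_) xs)
  c = count≥ (suc k) xs
  regroup : ∀ S k c → S + (1 + 2 * k) * c + suc k * suc k ≡ (S + k * k) + (1 + 2 * k) * suc c
  regroup = solve-∀

-- (F − g)² ≥ M² written without subtraction.
square-bound : ∀ M g F S → M + g ≤ F → S + g * g ≤ 2 * F * g → M * M + S ≤ F * F
square-bound M g F S M+g≤F S≤ with m≤n⇒∃[o]m+o≡n M+g≤F
... | e , refl = +-cancelʳ-≤ (g * g) _ _ (begin
  M * M + S + g * g                       ≡⟨ +-assoc (M * M) S (g * g) ⟩
  M * M + (S + g * g)                     ≤⟨ +-monoʳ-≤ (M * M) S≤ ⟩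
  M * M + 2 * (M + g + e) * g             ≤⟨ m≤m+n _ (e * e + 2 * M * e) ⟩
  M * M + 2 * (M + g + e) * g + (e * e + 2 * M * e) ≡⟨ expand M g e ⟩
  (M + g + e) * (M + g + e) + g * g       ∎)
  where
  open ≤-Reasoning
  expand : ∀ M g e → M * M + 2 * (M + g + e) * g + (e * e + 2 * M * e)
                   ≡ (M + g + e) * (M + g + e) + g * g
  expand = solve-∀

_≤*_ : List ℕ → List ℕ → Set
_≤*_ = Pointwise _≤_

positives : List ℕ → List ℕ
positives [] = []
positives (zero ∷ ds) = positives ds
positives (suc d ∷ ds) = suc d ∷ positives ds

Near : ℕ → ℕ → Set
Near a n = a ≤ n × n ≤ suc a

-- ds lists how many leaves to keep below each child of a vertex (0: drop the child).
FewOrBalanced : List ℕ → Set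
FewOrBalanced ds = length (positives ds) ≤ 2 ⊎ ∃[ a ] All (λ d → d ≡ 0 ⊎ Near a d) ds

Distribution : List ℕ → ℕ → Set
Distribution ms s = ∃[ ds ] ds ≤* ms × sum ds ≡ s × FewOrBalanced ds

length-positives-∷ : ∀ d ds → length (positives (d ∷ ds)) ≤ suc (length (positives ds))
length-positives-∷ zero ds = n≤1+n _
length-positives-∷ (suc d) ds = ≤-refl

zeros : List ℕ → List ℕ
zeros = map (λ _ → 0)

sum-zeros : ∀ xs → sum (zeros xs) ≡ 0
sum-zeros [] = refl
sum-zeros (x ∷ xs) = sum-zeros xs

zeros-≤* : ∀ xs → zeros xs ≤* xs
zeros-≤* [] = []
zeros-≤* (x ∷ xs) = z≤n ∷ zeros-≤* xs

positives-zeros : ∀ xs → positives (zeros xs) ≡ []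
positives-zeros [] = refl
positives-zeros (x ∷ xs) = positives-zeros xs

data Picked (x : ℕ) : List ℕ → List ℕ → Set where
  here  : ∀ {xs} → Picked x (x ∷ xs) (0 ∷ xs)
  there : ∀ {y xs ys} → Picked x xs ys → Picked x (y ∷ xs) (y ∷ ys)

module _ {x : ℕ} where

  Picked-sumSq : ∀ {xs ys} → Picked x xs ys → sumSq xs ≡ x * x + sumSq ys
  Picked-sumSq here = refl
  Picked-sumSq (there {y} p) rewrite Picked-sumSq p = x∙yz≈y∙xz (y * y) (x * x) _

  Picked-count≥ : ∀ {t xs ys} → Picked x xs ys → 1 ≤ t → t ≤ x →
                  count≥ t xs ≡ suc (count≥ t ys)
  Picked-count≥ {suc t} here _ t≤x with suc t ≤? x
  ... | yes _   = refl
  ... | no  t≰x = ⊥-elim (t≰x t≤x)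
  Picked-count≥ {t} (there {y} p) 1≤t t≤x with t ≤? y
  ... | yes _ = cong suc (Picked-count≥ p 1≤t t≤x)
  ... | no  _ = Picked-count≥ p 1≤t t≤x

  Picked-All : ∀ {P : ℕ → Set} {xs ys} → Picked x xs ys → All P xs → P 0 → All P ys
  Picked-All here (_ ∷ pxs) p0 = p0 ∷ pxs
  Picked-All (there p) (py ∷ pxs) p0 = py ∷ Picked-All p pxs p0

  Picked-lookup : ∀ {P : ℕ → Set} {xs ys} → Picked x xs ys → All P xs → P x
  Picked-lookup here (px ∷ _) = px
  Picked-lookup (there p) (_ ∷ pxs) = Picked-lookup p pxs

maximum : ∀ x xs → ∃[ M ] ∃[ ys ] Picked M (x ∷ xs) ys × All (_≤ M) (x ∷ xs)
maximum x [] = x , 0 ∷ [] , here , ≤-refl ∷ []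
maximum x (y ∷ ys) with maximum y ys
... | M , zs , p , ≤M with x ≤? M
...   | yes x≤M = M , x ∷ zs , there p , x≤M ∷ ≤M
...   | no  x≰M = x , 0 ∷ y ∷ ys , here , ≤-refl ∷ All.map (λ z≤M → ≤-trans z≤M (≰⇒≥ x≰M)) ≤M

single : ∀ {x xs ys} → Picked x xs ys → ℕ → List ℕ
single (here {xs}) a = a ∷ zeros xs
single (there p) a = 0 ∷ single p a

module _ {x : ℕ} where

  sum-single : ∀ {xs ys} (p : Picked x xs ys) a → sum (single p a) ≡ a
  sum-single (here {xs}) a = trans (cong (a +_) (sum-zeros xs)) (+-identityʳ a)
  sum-single (there p) a = sum-single p a

  single-≤* : ∀ {xs ys a} (p : Picked x xs ys) → a ≤ x → single p a ≤* xs
  single-≤* (here {xs}) a≤x = a≤x ∷ zeros-≤* xs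
  single-≤* (there p) a≤x = z≤n ∷ single-≤* p a≤x

  length-positives-single : ∀ {xs ys} (p : Picked x xs ys) a → length (positives (single p a)) ≤ 1
  length-positives-single (here {xs}) a = begin
    length (positives (a ∷ zeros xs))  ≤⟨ length-positives-∷ a (zeros xs) ⟩
    suc (length (positives (zeros xs))) ≡⟨ cong (suc ∘ length) (positives-zeros xs) ⟩
    1                                    ∎
    where open ≤-Reasoning
  length-positives-single (there p) a = length-positives-single p a

pair : ∀ {x y xs ys zs} → Picked x xs ys → Picked y ys zs → ℕ → ℕ → List ℕ
pair (here {xs}) here a b = a + b ∷ zeros xs
pair here (there q) a b = a ∷ single q b
pair (there p) here a b = b ∷ single p a
pair (there p) (there q) a b = 0 ∷ pair p q a b

module _ {x y : ℕ} where

  sum-pair : ∀ {xs ys zs} (p : Picked x xs ys) (q : Picked y ys zs) a b →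
             sum (pair p q a b) ≡ a + b
  sum-pair (here {xs}) here a b = trans (cong (a + b +_) (sum-zeros xs)) (+-identityʳ (a + b))
  sum-pair here (there q) a b = cong (a +_) (sum-single q b)
  sum-pair (there p) here a b = trans (cong (b +_) (sum-single p a)) (+-comm b a)
  sum-pair (there p) (there q) a b = sum-pair p q a b

  pair-≤* : ∀ {xs ys zs a b} (p : Picked x xs ys) (q : Picked y ys zs) → a ≤ x → b ≤ y →
            pair p q a b ≤* xs
  pair-≤* {a = a} (here {xs}) here a≤x b≤0 =
    ≤-trans (+-monoʳ-≤ a b≤0) (≤-trans (≤-reflexive (+-identityʳ a)) a≤x) ∷ zeros-≤* xs
  pair-≤* here (there q) a≤x b≤y = a≤x ∷ single-≤* q b≤y
  pair-≤* (there p) here a≤x b≤y = b≤y ∷ single-≤* p a≤x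
  pair-≤* (there p) (there q) a≤x b≤y = z≤n ∷ pair-≤* p q a≤x b≤y

  length-positives-pair : ∀ {xs ys zs} (p : Picked x xs ys) (q : Picked y ys zs) a b →
                          length (positives (pair p q a b)) ≤ 2
  length-positives-pair (here {xs}) here a b =
    ≤-trans (length-positives-∷ (a + b) (zeros xs))
            (s≤s (≤-trans (≤-reflexive (cong length (positives-zeros xs))) z≤n))
  length-positives-pair here (there q) a b =
    ≤-trans (length-positives-∷ a (single q b)) (s≤s (length-positives-single q b))
  length-positives-pair (there p) here a b =
    ≤-trans (length-positives-∷ b (single p a)) (s≤s (length-positives-single p a))
  length-positives-pair (there p) (there q) a b = length-positives-pair p q a b

pairDistribution : ∀ {x y xs ys zs s} → Picked x xs ys → Picked y ys zs → s ≤ x + y →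
                   Distribution xs s
pairDistribution {x} {s = s} p q s≤x+y =
  pair p q (x ⊓ s) (s ∸ x) ,
  pair-≤* p q (m⊓n≤m x s) (m≤n+o⇒m∸n≤o s x s≤x+y) ,
  trans (sum-pair p q (x ⊓ s) (s ∸ x)) (m⊓n+n∸m≡n x s) ,
  inj₁ (length-positives-pair p q (x ⊓ s) (s ∸ x))

spread : ℕ → ℕ → ℕ → List ℕ → List ℕ
spread t a r [] = []
spread t a r (x ∷ xs) with t ≤? x
spread t a r       (x ∷ xs) | no  _ = 0 ∷ spread t a r xs
spread t a zero    (x ∷ xs) | yes _ = a ∷ spread t a zero xs
spread t a (suc r) (x ∷ xs) | yes _ = suc a ∷ spread t a r xs

sum-spread : ∀ t a r xs → r ≤ count≥ t xs → sum (spread t a r xs) ≡ a * count≥ t xs + r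
sum-spread t a zero [] _ = cong (_+ 0) (sym (*-zeroʳ a))
sum-spread t a r (x ∷ xs) r≤c with t ≤? x
sum-spread t a r (x ∷ xs) r≤c | no _ = sum-spread t a r xs r≤c
sum-spread t a zero (x ∷ xs) _ | yes _ rewrite sum-spread t a zero xs z≤n = regroup a (count≥ t xs) 0
  where
  regroup : ∀ a c r → a + (a * c + r) ≡ a * suc c + r
  regroup = solve-∀
sum-spread t a (suc r) (x ∷ xs) r<c | yes _ rewrite sum-spread t a r xs (s≤s⁻¹ r<c) =
  regroup a (count≥ t xs) r
  where
  regroup : ∀ a c r → suc a + (a * c + r) ≡ a * suc c + suc r
  regroup = solve-∀

spread-≤* : ∀ {t a} r xs → a ≤ t → (0 < r → a < t) → spread t a r xs ≤* xs
spread-≤* r [] _ _ = []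
spread-≤* {t} r (x ∷ xs) a≤t a<t with t ≤? x
spread-≤* r       (x ∷ xs) a≤t a<t | no  _   = z≤n ∷ spread-≤* r xs a≤t a<t
spread-≤* zero    (x ∷ xs) a≤t _   | yes t≤x = ≤-trans a≤t t≤x ∷ spread-≤* zero xs a≤t λ ()
spread-≤* (suc r) (x ∷ xs) a≤t a<t | yes t≤x =
  ≤-trans (a<t z<s) t≤x ∷ spread-≤* r xs a≤t (λ _ → a<t z<s)

spread-near : ∀ t a r xs → All (λ d → d ≡ 0 ⊎ Near a d) (spread t a r xs)
spread-near t a r [] = []
spread-near t a r (x ∷ xs) with t ≤? x
spread-near t a r       (x ∷ xs) | no  _ = inj₁ refl ∷ spread-near t a r xs
spread-near t a zero    (x ∷ xs) | yes _ = inj₂ (≤-refl , n≤1+n a) ∷ spread-near t a zero xs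
spread-near t a (suc r) (x ∷ xs) | yes _ = inj₂ (n≤1+n a , ≤-refl) ∷ spread-near t a r xs

-- s = a·c + r with r < c: r of the c entries ≥ t receive a + 1 and the others a.
balancedDistribution : ∀ t xs {s} → 0 < s → s ≤ t * count≥ t xs → Distribution xs s
balancedDistribution t xs {s} 0<s s≤tc with count≥ t xs in c≡
... | zero = ⊥-elim (<⇒≱ 0<s (≤-trans s≤tc (≤-reflexive (*-zeroʳ t))))
... | suc c =
  spread t a r xs ,
  spread-≤* r xs a≤t a<t ,
  trans (sum-spread t a r xs (≤-trans (<⇒≤ (m%n<n s (suc c))) (≤-reflexive (sym c≡))))
        (trans (cong (λ n → a * n + r) c≡) (trans (+-comm (a * suc c) r) (sym s≡))) ,
  inj₂ (a , spread-near t a r xs)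
  where
  a = s / suc c
  r = s % suc c
  s≡ : s ≡ r + a * suc c
  s≡ = m≡m%n+[m/n]*n s (suc c)
  a≤t : a ≤ t
  a≤t = *-cancelʳ-≤ a t (suc c) (≤-trans (m/n*n≤m s (suc c)) s≤tc)
  a<t : 0 < r → a < t
  a<t 0<r = *-cancelʳ-< _ a t (begin-strict
    a * suc c     <⟨ +-monoˡ-< (a * suc c) 0<r ⟩
    r + a * suc c ≡⟨ s≡ ⟨
    s             ≤⟨ s≤tc ⟩
    t * suc c     ∎)
    where open ≤-Reasoning

layerMax : List ℕ → ℕ → ℕ
layerMax xs zero = 0
layerMax xs (suc k) = layerMax xs k ⊔ suc k * count≥ (suc k) xs

layerMax-≥ : ∀ xs {t k} → 1 ≤ t → t ≤ k → t * count≥ t xs ≤ layerMax xs k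
layerMax-≥ xs {k = zero} 1≤t t≤0 = ⊥-elim (<⇒≱ 1≤t t≤0)
layerMax-≥ xs {k = suc k} 1≤t t≤1+k with m≤n⇒m<n∨m≡n t≤1+k
... | inj₁ t<1+k = ≤-trans (layerMax-≥ xs 1≤t (s≤s⁻¹ t<1+k)) (m≤m⊔n _ _)
... | inj₂ refl  = m≤n⊔m _ _

layerMax-attained : ∀ xs k {s} → s ≤ layerMax xs k → ∃[ t ] s ≤ t * count≥ t xs
layerMax-attained xs zero s≤0 = 0 , s≤0
layerMax-attained xs (suc k) {s} s≤ with ⊔-sel (layerMax xs k) (suc k * count≥ (suc k) xs)
... | inj₁ eq = layerMax-attained xs k (≤-trans s≤ (≤-reflexive eq))
... | inj₂ eq = suc k , ≤-trans s≤ (≤-reflexive eq)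

Distributable : List ℕ → ℕ → Set
Distributable ms F = sumSq ms ≤ F * F × (∀ s → 1 ≤ s → s ≤ F → Distribution ms s)

distributable : ∀ m ms → 1 ≤ m → ∃[ F ] 1 ≤ F × Distributable (m ∷ ms) F
distributable m ms 1≤m with maximum m ms
... | M , [] , () , _
... | M , r ∷ rs , p , m≤M ∷ ms≤M with maximum r rs
...   | g , _ , q , rs≤g = F , 1≤F , sumSq≤F² , distribution
  where
  L = m ∷ ms
  R = r ∷ rs
  F = (M + g) ⊔ layerMax L g

  M+g≤F : M + g ≤ F
  M+g≤F = m≤m⊔n (M + g) (layerMax L g)

  1≤F : 1 ≤ F
  1≤F = ≤-trans 1≤m (≤-trans m≤M (≤-trans (m≤m+n M g) M+g≤F))

  g≤M : g ≤ M
  g≤M = Picked-lookup q (Picked-All p (m≤M ∷ ms≤M) z≤n)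

  layer≤F : ∀ t → 1 ≤ t → t ≤ g → t * suc (count≥ t R) ≤ F
  layer≤F t 1≤t t≤g = begin
    t * suc (count≥ t R) ≡⟨ cong (t *_) (Picked-count≥ p 1≤t (≤-trans t≤g g≤M)) ⟨
    t * count≥ t L       ≤⟨ layerMax-≥ L 1≤t t≤g ⟩
    layerMax L g         ≤⟨ m≤n⊔m (M + g) (layerMax L g) ⟩
    F                    ∎
    where open ≤-Reasoning

  sumSqR+g²≤2Fg : sumSq R + g * g ≤ 2 * F * g
  sumSqR+g²≤2Fg = subst (λ xs → sumSq xs + g * g ≤ 2 * F * g)
                        (map-id-local (All.map m≥n⇒m⊓n≡n rs≤g))
                        (sumSq-⊓-bound F g R layer≤F)

  sumSq≤F² : sumSq L ≤ F * F
  sumSq≤F² = begin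
    sumSq L         ≡⟨ Picked-sumSq p ⟩
    M * M + sumSq R ≤⟨ square-bound M g F (sumSq R) M+g≤F sumSqR+g²≤2Fg ⟩
    F * F           ∎
    where open ≤-Reasoning

  distribution : ∀ s → 1 ≤ s → s ≤ F → Distribution L s
  distribution s 1≤s s≤F with ⊔-sel (M + g) (layerMax L g)
  ... | inj₁ F≡M+g = pairDistribution p q (≤-trans s≤F (≤-reflexive F≡M+g))
  ... | inj₂ F≡layer with layerMax-attained L g (≤-trans s≤F (≤-reflexive F≡layer))
  ...   | t , s≤tc = balancedDistribution t L 1≤s s≤tc

record Selection (t : Tree) (s : ℕ) : Set where
  field
    subset      : Leaf t → Bool
    card-subset : card t subset ≡ s
    subtree     : Tree
    induced≡    : induced t subset ≡ just subtree
    binBal      : BinBal subtree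
    numLeaves≡  : numLeaves subtree ≡ s

record Selectable (t : Tree) (m : ℕ) : Set where
  field
    positive   : 1 ≤ m
    numLeaves≤ : numLeaves t ≤ m * m
    select     : ∀ s → 1 ≤ s → s ≤ m → Selection t s

data ChildSelection (t : Tree) : ℕ → Set where
  drop : ChildSelection t 0
  keep : ∀ {d} → Selection t (suc d) → ChildSelection t (suc d)

mutual
  card-none : ∀ t → card t (λ _ → false) ≡ 0
  card-none (node q []) = refl
  card-none (node q (t ∷ ts)) = cardL-none (t ∷ ts)

  cardL-none : ∀ ts → cardL ts (λ _ → false) ≡ 0
  cardL-none [] = refl
  cardL-none (t ∷ ts) = cong₂ _+_ (card-none t) (cardL-none ts)

mutual
  induced-none : ∀ t → induced t (λ _ → false) ≡ nothing
  induced-none (node q []) = refl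
  induced-none (node q (t ∷ ts)) rewrite inducedL-none (t ∷ ts) = refl

  inducedL-none : ∀ ts → inducedL ts (λ _ → false) ≡ []
  inducedL-none [] = refl
  inducedL-none (t ∷ ts) rewrite induced-none t = inducedL-none ts

subsetᴸ : ∀ {ts ds} → Pointwise ChildSelection ts ds → Any Leaf ts → Bool
subsetᴸ (drop ∷ _) (here _) = false
subsetᴸ (keep sel ∷ _) (here p) = Selection.subset sel p
subsetᴸ (_ ∷ cs) (there p) = subsetᴸ cs p

subtrees : ∀ {ts ds} → Pointwise ChildSelection ts ds → List Tree
subtrees [] = []
subtrees (drop ∷ cs) = subtrees cs
subtrees (keep sel ∷ cs) = Selection.subtree sel ∷ subtrees cs

cardL-subsetᴸ : ∀ {ts ds} (cs : Pointwise ChildSelection ts ds) →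
                cardL ts (subsetᴸ cs) ≡ sum ds
cardL-subsetᴸ [] = refl
cardL-subsetᴸ {t ∷ _} (drop ∷ cs) = cong₂ _+_ (card-none t) (cardL-subsetᴸ cs)
cardL-subsetᴸ (keep sel ∷ cs) = cong₂ _+_ (Selection.card-subset sel) (cardL-subsetᴸ cs)

inducedL-subsetᴸ : ∀ {ts ds} (cs : Pointwise ChildSelection ts ds) →
                   inducedL ts (subsetᴸ cs) ≡ subtrees cs
inducedL-subsetᴸ [] = refl
inducedL-subsetᴸ {t ∷ _} (drop ∷ cs) rewrite induced-none t = inducedL-subsetᴸ cs
inducedL-subsetᴸ (keep sel ∷ cs) rewrite Selection.induced≡ sel = cong (_ ∷_) (inducedL-subsetᴸ cs)

numLeavesL-subtrees : ∀ {ts ds} (cs : Pointwise ChildSelection ts ds) →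
                      numLeavesL (subtrees cs) ≡ sum ds
numLeavesL-subtrees [] = refl
numLeavesL-subtrees (drop ∷ cs) = numLeavesL-subtrees cs
numLeavesL-subtrees (keep sel ∷ cs) = cong₂ _+_ (Selection.numLeaves≡ sel) (numLeavesL-subtrees cs)

map-numLeaves-subtrees : ∀ {ts ds} (cs : Pointwise ChildSelection ts ds) →
                         map numLeaves (subtrees cs) ≡ positives ds
map-numLeaves-subtrees [] = refl
map-numLeaves-subtrees (drop ∷ cs) = map-numLeaves-subtrees cs
map-numLeaves-subtrees (keep sel ∷ cs) =
  cong₂ _∷_ (Selection.numLeaves≡ sel) (map-numLeaves-subtrees cs)

All-BinBal-subtrees : ∀ {ts ds} (cs : Pointwise ChildSelection ts ds) → All BinBal (subtrees cs)
All-BinBal-subtrees [] = []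
All-BinBal-subtrees (drop ∷ cs) = All-BinBal-subtrees cs
All-BinBal-subtrees (keep sel ∷ cs) = Selection.binBal sel ∷ All-BinBal-subtrees cs

All-positives : ∀ {P : ℕ → Set} {ds} → All (λ d → d ≡ 0 ⊎ P d) ds → All P (positives ds)
All-positives [] = []
All-positives {ds = zero ∷ _} (_ ∷ pds) = All-positives pds
All-positives {ds = suc _ ∷ _} (inj₁ () ∷ _)
All-positives {ds = suc _ ∷ _} (inj₂ pd ∷ pds) = pd ∷ All-positives pds

near⇒Balanced : ∀ {a} ts → All (Near a ∘ numLeaves) ts → Balanced ts
near⇒Balanced {a} ts near i j = begin
  numLeaves (lookup ts i)       ≤⟨ proj₂ (All.lookup near (∈-lookup i)) ⟩
  suc a                         ≤⟨ s≤s (proj₁ (All.lookup near (∈-lookup j))) ⟩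
  suc (numLeaves (lookup ts j)) ≡⟨ +-comm 1 _ ⟩
  numLeaves (lookup ts j) + 1   ∎
  where open ≤-Reasoning

FewOrBalanced⇒≤2⊎Balanced : ∀ ts ds → map numLeaves ts ≡ positives ds → FewOrBalanced ds →
                             length ts ≤ 2 ⊎ Balanced ts
FewOrBalanced⇒≤2⊎Balanced ts ds sizes (inj₁ few) =
  inj₁ (≤-trans (≤-reflexive (trans (sym (length-map numLeaves ts)) (cong length sizes))) few)
FewOrBalanced⇒≤2⊎Balanced ts ds sizes (inj₂ (a , near)) =
  inj₂ (near⇒Balanced ts (map⁻ (subst (All (Near a)) (sym sizes) (All-positives near))))

induced-node : ∀ q t ts (S : Leaf (node q (t ∷ ts)) → Bool) {o os} →
               inducedL (t ∷ ts) (S ∘ leafIn) ≡ o ∷ os →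
               induced (node q (t ∷ ts)) S ≡ just (node q (o ∷ os))
induced-node q t ts S eq rewrite eq = refl

nodeSelection : ∀ q t ts {ds} → Pointwise ChildSelection (t ∷ ts) ds → 1 ≤ sum ds →
                FewOrBalanced ds → Selection (node q (t ∷ ts)) (sum ds)
nodeSelection q t ts {ds} cs 1≤s few with subtrees cs in os≡
... | [] =
  ⊥-elim (<⇒≱ 1≤s (≤-reflexive (trans (sym (numLeavesL-subtrees cs)) (cong numLeavesL os≡))))
... | o ∷ os = record
  { subset      = S
  ; card-subset = cardL-subsetᴸ cs
  ; subtree     = node q (o ∷ os)
  ; induced≡    = induced-node q t ts S (trans (inducedL-subsetᴸ cs) os≡)
  ; binBal      = binbal (FewOrBalanced⇒≤2⊎Balanced (o ∷ os) ds sizes few)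
                         (subst (All BinBal) os≡ (All-BinBal-subtrees cs))
  ; numLeaves≡  = trans (cong numLeavesL (sym os≡)) (numLeavesL-subtrees cs)
  }
  where
  S : Leaf (node q (t ∷ ts)) → Bool
  S (leafIn p) = subsetᴸ cs p

  sizes : map numLeaves (o ∷ os) ≡ positives ds
  sizes = trans (cong (map numLeaves) (sym os≡)) (map-numLeaves-subtrees cs)

leafSelectable : ∀ q → Selectable (node q []) 1
leafSelectable q = record { positive = ≤-refl ; numLeaves≤ = ≤-refl ; select = select }
  where
  select : ∀ s → 1 ≤ s → s ≤ 1 → Selection (node q []) s
  select s 1≤s s≤1 with ≤-antisym s≤1 1≤s
  ... | refl = record
    { subset = λ _ → true ; card-subset = refl ; subtree = node q [] ; induced≡ = refl
    ; binBal = binbal (inj₁ z≤n) [] ; numLeaves≡ = refl }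

choose : ∀ {ts ms ds} → Pointwise Selectable ts ms → ds ≤* ms → Pointwise ChildSelection ts ds
choose [] [] = []
choose (_ ∷ sels) (z≤n ∷ ds≤) = drop ∷ choose sels ds≤
choose (sel ∷ sels) (d≤m@(s≤s _) ∷ ds≤) =
  keep (Selectable.select sel _ (s≤s z≤n) d≤m) ∷ choose sels ds≤

numLeavesL≤sumSq : ∀ {ts ms} → Pointwise Selectable ts ms → numLeavesL ts ≤ sumSq ms
numLeavesL≤sumSq [] = z≤n
numLeavesL≤sumSq (sel ∷ sels) = +-mono-≤ (Selectable.numLeaves≤ sel) (numLeavesL≤sumSq sels)

mutual
  selectable : (t : Tree) → ∃[ m ] Selectable t m
  selectable (node q []) = 1 , leafSelectable q
  selectable (node q (t ∷ ts)) with selectableᴸ (t ∷ ts)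
  ... | m ∷ ms , sels@(sel ∷ _) with distributable m ms (Selectable.positive sel)
  ...   | F , 1≤F , sumSq≤F² , distribution = F , record
    { positive   = 1≤F
    ; numLeaves≤ = ≤-trans (numLeavesL≤sumSq sels) sumSq≤F²
    ; select     = select
    }
    where
    select : ∀ s → 1 ≤ s → s ≤ F → Selection (node q (t ∷ ts)) s
    select s 1≤s s≤F with distribution s 1≤s s≤F
    ... | ds , ds≤ms , refl , few = nodeSelection q t ts (choose sels ds≤ms) 1≤s few

  selectableᴸ : (ts : List Tree) → ∃[ ms ] Pointwise Selectable ts ms
  selectableᴸ [] = [] , []
  selectableᴸ (t ∷ ts) with selectable t | selectableᴸ ts
  ... | m , sel | ms , sels = m ∷ ms , sel ∷ sels

lemma7p3 : (T : Tree) → IsHST T →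
    Σ (Leaf T → Bool) λ S →
      (numLeaves T ≤ card T S * card T S) ×
      Σ Tree λ T' → (induced T S ≡ just T') × BinBal T'
lemma7p3 T _ with selectable T
... | m , sel =
  subset , subst (λ n → numLeaves T ≤ n * n) (sym card-subset) numLeaves≤ ,
  subtree , induced≡ , binBal
  where
  open Selectable sel
  open Selection (select m positive ≤-refl)
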